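{- Let $k$ be an integer. Let $G$ be a graph and $V_1,V_2,\dots,V_r$ a partition of $V(G)$ with $|V_1|=\dots=|V_r|=m$ and $m>6kr$. Assume $V_i$ is gradually connected with $V_{i+1}$ for $i=1,\dots,r-1$. Assume further that there is a set $I\subseteq\{1,\dots,r\}$ with $|I|=2k$ such that for any $X$ a transversal of $\{V_i:i\in I\}$ and any $Y$ a transversal of $\{V_{i+1}:i\in I\}$, the set $X$ is gradually connected with $Y$. Then the clique-width of $G$ is at least $k$.
   Context: For disjoint vertex sets $X,Y$ of the same size $m$ in a graph, $X$ is gradually connected with $Y$ if there are orderings $X=\{x_1,\dots,x_m\}$, $Y=\{y_1,\dots,y_m\}$ such that for all $i<j$, $x_jy_i$ is an edge and $x_iy_j$ is not an edge (edges $x_iy_i$ are unrestricted). A transversal of a set system $\{X_1,\dots,X_s\}$ is a set $\{z_1,\dots,z_s\}$ of $s$ distinct elements with $z_i\in X_i$. The clique-width of $G$ is the minimum $k$ such that $G$ can be built from single vertices labelled $1$ using the operations: relabel all vertices with label $i$ to $j$; add all edges between vertices labelled $i$ and vertices labelled $j$; disjoint union; with labels from $\{1,\dots,k\}$. -}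

module Defs where

open import Data.Nat using (ℕ; zero; suc; _+_; _<_)
open import Data.Nat.Properties using () renaming (_≟_ to _≟ℕ_)
open import Data.Fin using (Fin; zero; suc; toℕ; splitAt)
open import Data.Fin.Properties using (_≟_)
open import Data.Fin.Subset using (Subset; inside; outside; _∈_)
open import Data.Bool using (Bool; true; false; _∧_; _∨_; if_then_else_)
open import Data.Vec using (tabulate)
open import Data.Sum using (_⊎_; inj₁; inj₂)
open import Data.Product using (Σ; ∃; _×_; _,_)
open import Data.Empty using (⊥)
open import Relation.Nullary using (¬_)
open import Relation.Nullary.Decidable using (⌊_⌋)
open import Relation.Binary.PropositionalEquality using (_≡_; _≢_)
open import Function.Definitions using (Injective; Bijective)
open import Function.Bundles using (_⇔_)

record Graph : Set where
  field
    n      : ℕ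
    adj    : Fin n → Fin n → Bool
    sym    : ∀ u v → adj u v ≡ adj v u
    irrefl : ∀ v → adj v v ≡ false

open Graph public

Edge : (G : Graph) → Fin (n G) → Fin (n G) → Set
Edge G u v = adj G u v ≡ true

Disjoint : ∀ {N} → Subset N → Subset N → Set
Disjoint X Y = ∀ v → v ∈ X → v ∈ Y → ⊥

IsOrdering : ∀ {N m} → Subset N → (Fin m → Fin N) → Set
IsOrdering X x = Injective _≡_ _≡_ x × (∀ v → (v ∈ X) ⇔ (∃ λ i → x i ≡ v))

GraduallyConnected : (G : Graph) → Subset (n G) → Subset (n G) → Set
GraduallyConnected G X Y =
  Disjoint X Y ×
  ∃ λ m → Σ (Fin m → Fin (n G)) λ x → Σ (Fin m → Fin (n G)) λ y →
    IsOrdering X x × IsOrdering Y y ×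
    (∀ (i j : Fin m) → toℕ i < toℕ j →
       Edge G (x j) (y i) × ¬ Edge G (x i) (y j))

Transversal : ∀ {N r} → Subset N → (Fin r → Subset N) → Subset r → Set
Transversal {N} {r} Z F I =
  Σ ((i : Fin r) → i ∈ I → Fin N) λ z →
    (∀ i (p : i ∈ I) → z i p ∈ F i) ×
    (∀ i j (p : i ∈ I) (q : j ∈ I) → z i p ≡ z j q → i ≡ j) ×
    (∀ v → (v ∈ Z) ⇔ (∃ λ i → Σ (i ∈ I) λ p → z i p ≡ v))

-- Parts of a partition given by a labelling part : Fin N → Fin r.
-- Parts are indexed 0..r-1 (paper: V_1..V_r); PartAt part j is the part
-- with (0-based) index j, empty if j ≥ r.

PartAt : ∀ {N r} → (Fin N → Fin r) → ℕ → Subset N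
PartAt part j = tabulate λ v → if ⌊ toℕ (part v) ≟ℕ j ⌋ then inside else outside

-- Clique-width: k-expressions (labels Fin k) indexed by number of vertices

data Expr : ℕ → ℕ → Set where
  -- a single vertex with label 1 (= zero : Fin (suc k))
  vertex  : ∀ {k} → Expr (suc k) 1
  relabel : ∀ {k N} → Fin k → Fin k → Expr k N → Expr k N
  join    : ∀ {k N} (i j : Fin k) → i ≢ j → Expr k N → Expr k N
  union   : ∀ {k a b} → Expr k a → Expr k b → Expr k (a + b)

label : ∀ {k N} → Expr k N → Fin N → Fin k
label vertex v = zero
label (relabel i j e) v = if ⌊ label e v ≟ i ⌋ then j else label e v
label (join i j _ e) v = label e v
label (union {a = a} e f) v with splitAt a v
... | inj₁ u = label e u
... | inj₂ u = label f u

eadj : ∀ {k N} → Expr k N → Fin N → Fin N → Bool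
eadj vertex u v = false
eadj (relabel i j e) u v = eadj e u v
eadj (join i j _ e) u v =
  eadj e u v
  ∨ (⌊ label e u ≟ i ⌋ ∧ ⌊ label e v ≟ j ⌋)
  ∨ (⌊ label e u ≟ j ⌋ ∧ ⌊ label e v ≟ i ⌋)
eadj (union {a = a} e f) u v with splitAt a u | splitAt a v
... | inj₁ u′ | inj₁ v′ = eadj e u′ v′
... | inj₂ u′ | inj₂ v′ = eadj f u′ v′
... | inj₁ _  | inj₂ _  = false
... | inj₂ _  | inj₁ _  = false

Defines : ∀ {k} (G : Graph) → Expr k (n G) → Set
Defines G e = Σ (Fin (n G) → Fin (n G)) λ f →
  Bijective _≡_ _≡_ f × (∀ u v → eadj e u v ≡ adj G (f u) (f v))

CliqueWidth≤ : ℕ → Graph → Set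
CliqueWidth≤ k G = ∃ λ (e : Expr k (n G)) → Defines G e

CliqueWidth≥ : ℕ → Graph → Set
CliqueWidth≥ k G = ∀ j → j < k → ¬ CliqueWidth≤ j G

module Submission where

-- Suppose G had a j-expression with j < k.  The vertices of any subexpression form a
-- "label module" W: j labels such that equally labelled vertices of W have the same
-- neighbours outside W.  Parts are indexed from 0 (V 0, …, V (r-1)); let T = 2kr.
--  * Descent: going down the expression into a child of weight > T while the weight
--    exceeds 2T yields a label module W with T < |W ∩ V 0| ≤ 2T.
--  * Balance: if X is gradually connected with Y, then |X ∩ W| and |Y ∩ W| differ by
--    less than 2k; otherwise 2k indices d with x_d ∈ W, y_d ∉ W (or vice versa) give k
--    interleaved ones, and pigeonhole on labels yields two equally labelled vertices of W
--    with different adjacency to one vertex outside W.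
-- So along the chain |W ∩ V c| stays within T of |W ∩ V 0|: each V i meets W and each
-- V (i+1), of size m > 3T, leaves W.  Representatives chosen for i ∈ I form transversals
-- X ⊆ W and Y disjoint from W, gradually connected by hypothesis, with |X ∩ W| = 2k and
-- |Y ∩ W| = 0, contradicting the balance.

open import Defs hiding (sym; irrefl)
open import Data.Nat using (ℕ; zero; suc; _+_; _*_; _≤_; _<_; s≤s; z≤n; _≤?_; _<?_)
open import Data.Nat.Properties
open import Data.Fin using (Fin; zero; suc; toℕ; fromℕ<; _↑ˡ_; _↑ʳ_; splitAt)
open import Data.Fin.Properties
  using (toℕ-injective; toℕ-fromℕ<; toℕ<n; injective⇒≤; pigeonhole; any?;
         ↑ˡ-injective; ↑ʳ-injective; splitAt-↑ˡ; splitAt-↑ʳ; splitAt⁻¹-↑ˡ; splitAt⁻¹-↑ʳ)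
  renaming (_≟_ to _≟ᶠ_; suc-injective to fsuc-injective)
open import Data.Fin.Subset using (Subset; ∣_∣; _∈_)
open import Data.Fin.Subset.Properties using (_∈?_)
open import Data.Vec using ([]; _∷_; lookup; tabulate)
open import Data.Vec.Base using (here; there)
open import Data.Vec.Properties using ([]=⇒lookup; lookup⇒[]=; lookup∘tabulate)
open import Data.Bool using (Bool; true; false; _∧_; _∨_; not; if_then_else_)
open import Data.Bool.Properties using (∧-comm)
open import Data.Sum using (_⊎_; inj₁; inj₂)
open import Data.Product using (Σ; ∃; _×_; _,_; proj₁; proj₂)
open import Data.Empty using (⊥; ⊥-elim)
open import Function using (_∘_; id)
open import Function.Bundles using (_⇔_; mk⇔; Equivalence)
open import Function.Definitions using (Injective)
open import Relation.Nullary using (¬_; Dec; yes; no; does)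
open import Relation.Nullary.Decidable using (⌊_⌋; dec-true)
open import Relation.Binary.PropositionalEquality
open import Relation.Binary.Definitions using (tri<; tri≈; tri>)
open import Data.Nat.Tactic.RingSolver using (solve-∀)

open Equivalence using (to; from)

does-true : ∀ {A : Set} (d : Dec A) → does d ≡ true → A
does-true (yes a) _ = a
does-true (no _) ()

∧-true : ∀ {a b} → a ∧ b ≡ true → a ≡ true × b ≡ true
∧-true {true} {true} _ = refl , refl

not-true : ∀ {a} → not a ≡ true → a ≡ false
not-true {false} _ = refl

true≢false : true ≢ false
true≢false ()

-- Counting the positions of Fin a where a Boolean predicate holds

indicator : Bool → ℕ
indicator true  = 1
indicator false = 0

count : ∀ {a} → (Fin a → Bool) → ℕ
count {zero}  P = 0
count {suc a} P = indicator (P zero) + count (P ∘ suc)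

StrictlyIncreasing : ∀ {a b} → (Fin a → Fin b) → Set
StrictlyIncreasing s = ∀ t t' → toℕ t < toℕ t' → toℕ (s t) < toℕ (s t')

strictlyIncreasing⇒injective : ∀ {a b} (s : Fin a → Fin b) → StrictlyIncreasing s →
  Injective _≡_ _≡_ s
strictlyIncreasing⇒injective s inc {t} {t'} eq with <-cmp (toℕ t) (toℕ t')
... | tri< lt _ _ = ⊥-elim (<-irrefl (cong toℕ eq) (inc t t' lt))
... | tri≈ _ e _  = toℕ-injective e
... | tri> _ _ gt = ⊥-elim (<-irrefl (cong toℕ (sym eq)) (inc t' t gt))

enumerate : ∀ {a} (P : Fin a → Bool) →
  Σ (Fin (count P) → Fin a) λ s → (∀ t → P (s t) ≡ true) × StrictlyIncreasing s
enumerate {zero} P = (λ ()) , (λ ()) , λ ()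
enumerate {suc a} P with P zero in eq | enumerate (P ∘ suc)
... | true | s , Ps , inc = s′ , Ps′ , inc′
  where
  s′ : Fin (suc (count (P ∘ suc))) → Fin (suc a)
  s′ zero    = zero
  s′ (suc t) = suc (s t)
  Ps′ : ∀ t → P (s′ t) ≡ true
  Ps′ zero    = eq
  Ps′ (suc t) = Ps t
  inc′ : StrictlyIncreasing s′
  inc′ zero    (suc t') _         = s≤s z≤n
  inc′ (suc t) (suc t') (s≤s lt) = s≤s (inc t t' lt)
... | false | s , Ps , inc = suc ∘ s , Ps , λ t t' lt → s≤s (inc t t' lt)

rank : ∀ {b} (Q : Fin b → Bool) (v : Fin b) → Q v ≡ true → Fin (count Q)
rank Q zero q with Q zero
... | true = zero
rank Q (suc v) q with Q zero
... | true  = suc (rank (Q ∘ suc) v q)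
... | false = rank (Q ∘ suc) v q

rank-injective : ∀ {b} (Q : Fin b → Bool) v v' q q' → rank Q v q ≡ rank Q v' q' → v ≡ v'
rank-injective Q zero zero q q' _ = refl
rank-injective Q zero (suc v') q q' e with Q zero
rank-injective Q zero (suc v') q q' () | true
rank-injective Q (suc v) zero q q' e with Q zero
rank-injective Q (suc v) zero q q' () | true
rank-injective Q (suc v) (suc v') q q' e with Q zero
... | true  = cong suc (rank-injective (Q ∘ suc) v v' q q' (fsuc-injective e))
... | false = cong suc (rank-injective (Q ∘ suc) v v' q q' e)

count-injection : ∀ {a b} (P : Fin a → Bool) (Q : Fin b → Bool)
  (h : ∀ d → P d ≡ true → Fin b) → (∀ d d' p p' → h d p ≡ h d' p' → d ≡ d') →
  (∀ d p → Q (h d p) ≡ true) → count P ≤ count Q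
count-injection P Q h h-inj hQ with enumerate P
... | s , Ps , inc = injective⇒≤ {f = λ t → rank Q (h (s t) (Ps t)) (hQ (s t) (Ps t))}
  λ {t} {t'} e → strictlyIncreasing⇒injective s inc
    (h-inj _ _ _ _ (rank-injective Q _ _ (hQ (s t) (Ps t)) (hQ (s t') (Ps t')) e))

count-ext : ∀ {a} (P Q : Fin a → Bool) → (∀ d → P d ≡ Q d) → count P ≡ count Q
count-ext {zero}  P Q eq = refl
count-ext {suc a} P Q eq = cong₂ (λ b c → indicator b + c) (eq zero) (count-ext _ _ (eq ∘ suc))

count-none : ∀ {a} (P : Fin a → Bool) → (∀ d → P d ≡ false) → count P ≡ 0
count-none {zero}  P none = refl
count-none {suc a} P none rewrite none zero = count-none (P ∘ suc) (none ∘ suc)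

count-append : ∀ a {b} (P : Fin (a + b) → Bool) →
  count P ≡ count (P ∘ (_↑ˡ b)) + count (P ∘ (a ↑ʳ_))
count-append zero    P = refl
count-append (suc a) P =
  trans (cong (indicator (P zero) +_) (count-append a (P ∘ suc)))
        (sym (+-assoc (indicator (P zero)) _ _))

interchange : ∀ a b c d → (a + b) + (c + d) ≡ (a + c) + (b + d)
interchange = solve-∀

count-split : ∀ {a} (P Q R : Fin a → Bool) →
  (∀ d → indicator (P d) ≡ indicator (Q d) + indicator (R d)) → count P ≡ count Q + count R
count-split {zero}  P Q R h = refl
count-split {suc a} P Q R h =
  trans (cong₂ _+_ (h zero) (count-split (P ∘ suc) (Q ∘ suc) (R ∘ suc) (h ∘ suc)))
        (interchange (indicator (Q zero)) (indicator (R zero)) (count (Q ∘ suc)) (count (R ∘ suc)))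

count-subadditive : ∀ {a} (P Q R : Fin a → Bool) →
  (∀ d → indicator (P d) ≤ indicator (Q d) + indicator (R d)) → count P ≤ count Q + count R
count-subadditive {zero}  P Q R h = z≤n
count-subadditive {suc a} P Q R h =
  ≤-trans (+-mono-≤ (h zero) (count-subadditive (P ∘ suc) (Q ∘ suc) (R ∘ suc) (h ∘ suc)))
          (≤-reflexive (interchange (indicator (Q zero)) (indicator (R zero))
                                    (count (Q ∘ suc)) (count (R ∘ suc))))

count-witness : ∀ {a} (P : Fin a → Bool) → 0 < count P → ∃ λ d → P d ≡ true
count-witness P pos with enumerate P
... | s , Ps , _ with count P
... | suc _ = s zero , Ps zero

count-gap : ∀ {a} (P Q : Fin a → Bool) → count (λ d → P d ∧ Q d) < count P →
  ∃ λ d → P d ≡ true × Q d ≡ false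
count-gap P Q gap with count-witness (λ d → P d ∧ not (Q d)) positive
  where
  split : ∀ b c → indicator b ≡ indicator (b ∧ c) + indicator (b ∧ not c)
  split true true   = refl
  split true false  = refl
  split false _     = refl
  total : count P ≡ count (λ d → P d ∧ Q d) + count (λ d → P d ∧ not (Q d))
  total = count-split P (λ d → P d ∧ Q d) (λ d → P d ∧ not (Q d)) (λ d → split (P d) (Q d))
  positive : 0 < count (λ d → P d ∧ not (Q d))
  positive = +-cancelˡ-< (count (λ d → P d ∧ Q d)) 0 _
    (subst₂ _<_ (sym (+-identityʳ _)) total gap)
... | d , PQ = d , proj₁ (∧-true PQ) , not-true (proj₂ (∧-true PQ))

∣∣≡count : ∀ {N} (S : Subset N) → ∣ S ∣ ≡ count (lookup S)
∣∣≡count []          = refl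
∣∣≡count (true ∷ S)  = cong suc (∣∣≡count S)
∣∣≡count (false ∷ S) = ∣∣≡count S

Interleaved : ∀ {k L} → (Fin k → Fin L) → (Fin k → Fin L) → Set
Interleaved p q =
  (∀ t → toℕ (p t) < toℕ (q t)) × (∀ s t → toℕ s < toℕ t → toℕ (q s) < toℕ (p t))

-- Among 2k positions satisfying D, the even- and odd-numbered ones interleave.
interleaved-positions : ∀ k {L} (D : Fin L → Bool) → k + k ≤ count D →
  Σ (Fin k → Fin L) λ p → Σ (Fin k → Fin L) λ q →
    Interleaved p q × (∀ t → D (p t) ≡ true) × (∀ t → D (q t) ≡ true)
interleaved-positions k D 2k≤ with enumerate D
... | s , Ds , inc = s ∘ even , s ∘ odd ,
      ((λ t → inc (even t) (odd t) (subst₂ _<_ (sym (even≡ t)) (sym (odd≡ t)) (n<1+n _))) ,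
       (λ u t u<t → inc (odd u) (even t) (subst₂ _<_ (sym (odd≡ u)) (sym (even≡ t)) (odd<even u t u<t)))) ,
      Ds ∘ even , Ds ∘ odd
  where
  double-suc : ∀ t → suc t + suc t ≡ suc (suc (t + t))
  double-suc t = cong suc (+-suc t t)
  odd-bound : ∀ (t : Fin k) → suc (toℕ t + toℕ t) < count D
  odd-bound t = ≤-trans (≤-reflexive (sym (double-suc (toℕ t))))
                        (≤-trans (+-mono-≤ (toℕ<n t) (toℕ<n t)) 2k≤)
  even : Fin k → Fin (count D)
  even t = fromℕ< (<-trans (n<1+n _) (odd-bound t))
  odd : Fin k → Fin (count D)
  odd t = fromℕ< (odd-bound t)
  even≡ : ∀ t → toℕ (even t) ≡ toℕ t + toℕ t
  even≡ t = toℕ-fromℕ< _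
  odd≡ : ∀ t → toℕ (odd t) ≡ suc (toℕ t + toℕ t)
  odd≡ t = toℕ-fromℕ< _
  odd<even : ∀ (u t : Fin k) → toℕ u < toℕ t → suc (toℕ u + toℕ u) < toℕ t + toℕ t
  odd<even u t u<t = subst (_≤ toℕ t + toℕ t) (double-suc (toℕ u)) (+-mono-≤ u<t u<t)

inImage : ∀ {a N} → (Fin a → Fin N) → Fin N → Bool
inImage g v = does (any? λ w → g w ≟ᶠ v)

inImage-spec : ∀ {a N} (g : Fin a → Fin N) v → (inImage g v ≡ true) ⇔ (∃ λ w → g w ≡ v)
inImage-spec g v = mk⇔ (does-true (any? λ w → g w ≟ᶠ v)) (dec-true (any? λ w → g w ≟ᶠ v))

count-along : ∀ {a N} (S : Fin N → Bool) (g : Fin a → Fin N) → Injective _≡_ _≡_ g →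
  (∀ v → (S v ≡ true) ⇔ (∃ λ w → g w ≡ v)) → (P : Fin N → Bool) →
  count (P ∘ g) ≡ count (λ v → S v ∧ P v)
count-along S g g-inj S⇔ P = ≤-antisym forward backward
  where
  preimage : ∀ v → S v ∧ P v ≡ true → ∃ λ w → g w ≡ v
  preimage v q = to (S⇔ v) (proj₁ (∧-true q))
  forward : count (P ∘ g) ≤ count (λ v → S v ∧ P v)
  forward = count-injection _ _ (λ d _ → g d) (λ d d' _ _ → g-inj)
    (λ d Pgd → cong₂ _∧_ (from (S⇔ (g d)) (d , refl)) Pgd)
  backward : count (λ v → S v ∧ P v) ≤ count (P ∘ g)
  backward = count-injection _ _ (λ v q → proj₁ (preimage v q))
    (λ v v' q q' eq → trans (sym (proj₂ (preimage v q)))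
                            (trans (cong g eq) (proj₂ (preimage v' q'))))
    (λ v q → trans (cong P (proj₂ (preimage v q))) (proj₂ (∧-true q)))

ordering-count : ∀ {N L} {S : Subset N} {x : Fin L → Fin N} → IsOrdering S x →
  (P : Fin N → Bool) → count (P ∘ x) ≡ count (λ v → lookup S v ∧ P v)
ordering-count {S = S} (x-inj , S⇔) = count-along (lookup S) _ x-inj λ v →
  mk⇔ (λ q → to (S⇔ v) (lookup⇒[]= v S q)) (λ e → []=⇒lookup (from (S⇔ v) e))

-- Membership proofs in a subset are unique (needed to decide "z i p ≡ v for some p").
∈-unique : ∀ {r} {I : Subset r} {i} (p q : i ∈ I) → p ≡ q
∈-unique here      here      = refl
∈-unique (there p) (there q) = cong there (∈-unique p q)

module _ {N r : ℕ} (I : Subset r) (z : (i : Fin r) → i ∈ I → Fin N) where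

  Chosen? : ∀ v → Dec (∃ λ i → Σ (i ∈ I) λ p → z i p ≡ v)
  Chosen? v = any? chosen-at?
    where
    chosen-at? : ∀ i → Dec (Σ (i ∈ I) λ p → z i p ≡ v)
    chosen-at? i with i ∈? I
    ... | no i∉I = no (i∉I ∘ proj₁)
    ... | yes p with z i p ≟ᶠ v
    ...   | yes eq = yes (p , eq)
    ...   | no neq = no λ { (p' , eq) → neq (subst (λ p″ → z i p″ ≡ v) (∈-unique p' p) eq) }

  Chosen : Subset N
  Chosen = tabulate (does ∘ Chosen?)

  ∈-Chosen : ∀ v → (v ∈ Chosen) ⇔ (∃ λ i → Σ (i ∈ I) λ p → z i p ≡ v)
  ∈-Chosen v = mk⇔
    (λ v∈ → does-true (Chosen? v) (trans (sym (lookup∘tabulate _ v)) ([]=⇒lookup v∈)))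
    (λ e → lookup⇒[]= v Chosen (trans (lookup∘tabulate _ v) (dec-true (Chosen? v) e)))

  chosen-member : ∀ i p → lookup Chosen (z i p) ≡ true
  chosen-member i p = []=⇒lookup (from (∈-Chosen (z i p)) (i , p , refl))

  chosen-avoids : (Q : Fin N → Bool) → (∀ i p → Q (z i p) ≡ false) →
    ∀ v → lookup Chosen v ∧ Q v ≡ false
  chosen-avoids Q avoid v with lookup Chosen v in v∈
  ... | false = refl
  ... | true with to (∈-Chosen v) (lookup⇒[]= v Chosen v∈)
  ...   | i , p , refl = avoid i p

  chosen-transversal : (F : Fin r → Subset N) → (∀ i p → z i p ∈ F i) →
    (∀ i i' p p' → z i p ≡ z i' p' → i ≡ i') → Transversal Chosen F I
  chosen-transversal F zF z-inj = z , zF , z-inj , ∈-Chosen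

-- Subexpressions of k-expressions

-- SubExpr e e' g: e' occurs inside e, and g embeds the vertices of e' into those of e.
data SubExpr {j : ℕ} : ∀ {N a} → Expr j N → Expr j a → (Fin a → Fin N) → Set where
  self      : ∀ {a} {e : Expr j a} → SubExpr e e id
  inRelabel : ∀ {N a i i'} {e : Expr j N} {e' : Expr j a} {g} →
              SubExpr e e' g → SubExpr (relabel i i' e) e' g
  inJoin    : ∀ {N a i i' i≢i'} {e : Expr j N} {e' : Expr j a} {g} →
              SubExpr e e' g → SubExpr (join i i' i≢i' e) e' g
  inLeft    : ∀ {b c a} {e₁ : Expr j b} {e₂ : Expr j c} {e' : Expr j a} {g} →
              SubExpr e₁ e' g → SubExpr (union e₁ e₂) e' (λ u → g u ↑ˡ c)
  inRight   : ∀ {b c a} {e₁ : Expr j b} {e₂ : Expr j c} {e' : Expr j a} {g} →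
              SubExpr e₂ e' g → SubExpr (union e₁ e₂) e' (λ u → b ↑ʳ g u)

subExpr-injective : ∀ {j N a} {e : Expr j N} {e' : Expr j a} {g} →
  SubExpr e e' g → Injective _≡_ _≡_ g
subExpr-injective self          eq = eq
subExpr-injective (inRelabel p) eq = subExpr-injective p eq
subExpr-injective (inJoin p)    eq = subExpr-injective p eq
subExpr-injective (inLeft {c = c} p)  eq = subExpr-injective p (↑ˡ-injective c _ _ eq)
subExpr-injective (inRight {b = b} p) eq = subExpr-injective p (↑ʳ-injective b _ _ eq)

module UnionBlocks {j b c : ℕ} (e₁ : Expr j b) (e₂ : Expr j c) where
  label-left : ∀ x → label (union e₁ e₂) (x ↑ˡ c) ≡ label e₁ x
  label-left x rewrite splitAt-↑ˡ b x c = refl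
  label-right : ∀ x → label (union e₁ e₂) (b ↑ʳ x) ≡ label e₂ x
  label-right x rewrite splitAt-↑ʳ b c x = refl
  edge-left : ∀ x y → eadj (union e₁ e₂) (x ↑ˡ c) (y ↑ˡ c) ≡ eadj e₁ x y
  edge-left x y rewrite splitAt-↑ˡ b x c | splitAt-↑ˡ b y c = refl
  edge-left-right : ∀ x y → eadj (union e₁ e₂) (x ↑ˡ c) (b ↑ʳ y) ≡ false
  edge-left-right x y rewrite splitAt-↑ˡ b x c | splitAt-↑ʳ b c y = refl
  edge-right-left : ∀ x y → eadj (union e₁ e₂) (b ↑ʳ x) (y ↑ˡ c) ≡ false
  edge-right-left x y rewrite splitAt-↑ʳ b c x | splitAt-↑ˡ b y c = refl
  edge-right : ∀ x y → eadj (union e₁ e₂) (b ↑ʳ x) (b ↑ʳ y) ≡ eadj e₂ x y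
  edge-right x y rewrite splitAt-↑ʳ b c x | splitAt-↑ʳ b c y = refl

-- Two vertices with the same label in a subexpression keep equal labels in the whole
-- expression and have the same adjacency to every vertex outside the subexpression:
-- operations above e' act on labels only, and unions add no edges.
subExpr-twins : ∀ {j N a} {e : Expr j N} {e' : Expr j a} {g} → SubExpr e e' g →
  ∀ u u' → label e' u ≡ label e' u' →
  label e (g u) ≡ label e (g u') × (∀ v → (∀ w → g w ≢ v) → eadj e (g u) v ≡ eadj e (g u') v)
subExpr-twins self u u' same = same , λ v outside → ⊥-elim (outside v refl)
subExpr-twins (inRelabel {i = i} {i' = i'} p) u u' same with subExpr-twins p u u' same
... | lab , edges = cong (λ l → if ⌊ l ≟ᶠ i ⌋ then i' else l) lab , edges
subExpr-twins (inJoin {i = i} {i' = i'} {e = e} p) u u' same with subExpr-twins p u u' same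
... | lab , edges = lab , λ v outside →
  cong₂ (λ a l → a ∨ (⌊ l ≟ᶠ i ⌋ ∧ ⌊ label e v ≟ᶠ i' ⌋) ∨ (⌊ l ≟ᶠ i' ⌋ ∧ ⌊ label e v ≟ᶠ i ⌋))
        (edges v outside) lab
subExpr-twins (inLeft {b = b} {c = c} {e₁ = e₁} {e₂ = e₂} {g = g} p) u u' same
  with subExpr-twins p u u' same
... | lab , edges =
  trans (label-left (g u)) (trans lab (sym (label-left (g u')))) ,
  λ v outside → by-block v outside (splitAt b v) refl
  where
  open UnionBlocks e₁ e₂
  by-block : ∀ v → (∀ w → g w ↑ˡ c ≢ v) → (s : Fin b ⊎ Fin c) → splitAt b v ≡ s →
    eadj (union e₁ e₂) (g u ↑ˡ c) v ≡ eadj (union e₁ e₂) (g u' ↑ˡ c) v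
  by-block v outside (inj₁ v') eq with splitAt⁻¹-↑ˡ eq
  ... | refl = trans (edge-left (g u) v')
    (trans (edges v' (λ w gw → outside w (cong (_↑ˡ c) gw))) (sym (edge-left (g u') v')))
  by-block v outside (inj₂ v') eq with splitAt⁻¹-↑ʳ eq
  ... | refl = trans (edge-left-right (g u) v') (sym (edge-left-right (g u') v'))
subExpr-twins (inRight {b = b} {c = c} {e₁ = e₁} {e₂ = e₂} {g = g} p) u u' same
  with subExpr-twins p u u' same
... | lab , edges =
  trans (label-right (g u)) (trans lab (sym (label-right (g u')))) ,
  λ v outside → by-block v outside (splitAt b v) refl
  where
  open UnionBlocks e₁ e₂
  by-block : ∀ v → (∀ w → b ↑ʳ g w ≢ v) → (s : Fin b ⊎ Fin c) → splitAt b v ≡ s →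
    eadj (union e₁ e₂) (b ↑ʳ g u) v ≡ eadj (union e₁ e₂) (b ↑ʳ g u') v
  by-block v outside (inj₂ v') eq with splitAt⁻¹-↑ʳ eq
  ... | refl = trans (edge-right (g u) v')
    (trans (edges v' (λ w gw → outside w (cong (b ↑ʳ_) gw))) (sym (edge-right (g u') v')))
  by-block v outside (inj₁ v') eq with splitAt⁻¹-↑ˡ eq
  ... | refl = trans (edge-right-left (g u) v') (sym (edge-right-left (g u') v'))

Balanced : ℕ → ℕ → Set
Balanced T c = T < c × c ≤ T + T

-- Descent: for a weight w on the vertices with T < count w, some subexpression carries
-- a weight in (T, 2T].  Descend into a child of weight > T while the weight exceeds 2T;
-- a union of two children of weight ≤ T has weight ≤ 2T, and a single vertex weighs ≤ 1.
module _ (T : ℕ) (1≤T : 1 ≤ T) where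

  descend : ∀ {j b} (e : Expr j b) (w : Fin b → Bool) → T < count w →
    Σ ℕ λ a → Σ (Expr j a) λ e' → Σ (Fin a → Fin b) λ g →
      SubExpr e e' g × Balanced T (count (w ∘ g))
  descend-heavy : ∀ {j b} (e : Expr j b) (w : Fin b → Bool) → T + T < count w →
    Σ ℕ λ a → Σ (Expr j a) λ e' → Σ (Fin a → Fin b) λ g →
      SubExpr e e' g × Balanced T (count (w ∘ g))

  descend e w T<w with count w ≤? T + T
  ... | yes w≤2T = _ , e , id , self , T<w , w≤2T
  ... | no  w≰2T = descend-heavy e w (≰⇒> w≰2T)

  descend-heavy vertex w heavy =
    ⊥-elim (<⇒≱ heavy (≤-trans (≤-reflexive (+-identityʳ _))
                       (≤-trans (indicator≤1 (w zero)) (≤-trans 1≤T (m≤m+n T T)))))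
    where
    indicator≤1 : ∀ b → indicator b ≤ 1
    indicator≤1 true  = s≤s z≤n
    indicator≤1 false = z≤n
  descend-heavy (relabel i i' e) w heavy with descend e w (<-trans (m<m+n T 1≤T) heavy)
  ... | a , e' , g , p , bal = a , e' , g , inRelabel p , bal
  descend-heavy (join i i' i≢i' e) w heavy with descend e w (<-trans (m<m+n T 1≤T) heavy)
  ... | a , e' , g , p , bal = a , e' , g , inJoin p , bal
  descend-heavy (union {a = b} {b = c} e₁ e₂) w heavy
    with T <? count (w ∘ (_↑ˡ c)) | T <? count (w ∘ (b ↑ʳ_))
  ... | yes T<left | _ with descend e₁ (w ∘ (_↑ˡ c)) T<left
  ...   | a , e' , g , p , bal = a , e' , _ , inLeft p , bal
  descend-heavy (union {a = b} {b = c} e₁ e₂) w heavy | no _ | yes T<right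
    with descend e₂ (w ∘ (b ↑ʳ_)) T<right
  ...   | a , e' , g , p , bal = a , e' , _ , inRight p , bal
  descend-heavy (union {a = b} {b = c} e₁ e₂) w heavy | no left≤T | no right≤T =
    ⊥-elim (<⇒≱ heavy (≤-trans (≤-reflexive (count-append b w))
                                (+-mono-≤ (≮⇒≥ left≤T) (≮⇒≥ right≤T))))

-- Label modules

record LabelModule (G : Graph) (j : ℕ) : Set where
  field
    inside : Fin (n G) → Bool
    colour : ∀ v → inside v ≡ true → Fin j
    twins  : ∀ u u' v (pu : inside u ≡ true) (pu' : inside u' ≡ true) → inside v ≡ false →
             colour u pu ≡ colour u' pu' → adj G u v ≡ adj G u' v

open LabelModule

meet : ∀ {G j} → LabelModule G j → Subset (n G) → ℕ
meet W S = count (λ v → lookup S v ∧ inside W v)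

balanced-module : ∀ {j} {G : Graph} → CliqueWidth≤ j G → (P : Fin (n G) → Bool) →
  (T : ℕ) → 1 ≤ T → T < count P →
  Σ (LabelModule G j) λ W → Balanced T (count (λ v → P v ∧ inside W v))
balanced-module {j} {G} (e , f , (f-inj , f-surj) , f-iso) P T 1≤T T<P
  with descend T 1≤T e (P ∘ f) (subst (T <_) (sym (count-along (λ _ → true) f f-inj onto P)) T<P)
  where
  onto : ∀ v → (true ≡ true) ⇔ (∃ λ w → f w ≡ v)
  onto v = mk⇔ (λ _ → proj₁ (f-surj v) , proj₂ (f-surj v) refl) (λ _ → refl)
... | a , e' , g , p , T<Pfg , Pfg≤2T = W , subst (Balanced T) weight (T<Pfg , Pfg≤2T)
  where
  h : Fin a → Fin (n G)
  h = f ∘ g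
  h-inj : Injective _≡_ _≡_ h
  h-inj = subExpr-injective p ∘ f-inj
  f⁻¹ : Fin (n G) → Fin (n G)
  f⁻¹ v = proj₁ (f-surj v)
  f∘f⁻¹ : ∀ v → f (f⁻¹ v) ≡ v
  f∘f⁻¹ v = proj₂ (f-surj v) refl
  preimage : ∀ v → inImage h v ≡ true → ∃ λ w → h w ≡ v
  preimage v = to (inImage-spec h v)
  outside-g : ∀ v → inImage h v ≡ false → ∀ w → g w ≢ f⁻¹ v
  outside-g v out w gw≡ = true≢false (trans (sym (from (inImage-spec h v)
    (w , trans (cong f gw≡) (f∘f⁻¹ v)))) out)
  twins-h : ∀ u u' v (pu : inImage h u ≡ true) (pu' : inImage h u' ≡ true) →
    inImage h v ≡ false → label e' (proj₁ (preimage u pu)) ≡ label e' (proj₁ (preimage u' pu')) →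
    adj G u v ≡ adj G u' v
  twins-h u u' v pu pu' out same with preimage u pu | preimage u' pu'
  ... | w , refl | w' , refl = begin
    adj G (f (g w)) v                ≡⟨ cong (adj G (f (g w))) (sym (f∘f⁻¹ v)) ⟩
    adj G (f (g w)) (f (f⁻¹ v))      ≡⟨ sym (f-iso (g w) (f⁻¹ v)) ⟩
    eadj e (g w) (f⁻¹ v)             ≡⟨ proj₂ (subExpr-twins p w w' same) (f⁻¹ v) (outside-g v out) ⟩
    eadj e (g w') (f⁻¹ v)            ≡⟨ f-iso (g w') (f⁻¹ v) ⟩
    adj G (f (g w')) (f (f⁻¹ v))     ≡⟨ cong (adj G (f (g w'))) (f∘f⁻¹ v) ⟩
    adj G (f (g w')) v               ∎
    where open ≡-Reasoning
  W : LabelModule G j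
  W = record { inside = inImage h
             ; colour = λ v pv → label e' (proj₁ (preimage v pv))
             ; twins  = twins-h }
  weight : count (P ∘ h) ≡ count (λ v → P v ∧ inImage h v)
  weight = trans (count-along (inImage h) h h-inj (inImage-spec h) P)
                 (count-ext _ _ λ v → ∧-comm (inImage h v) (P v))

-- Label modules cannot separate gradually connected sets much

Gradual : (G : Graph) → ∀ {L} → (Fin L → Fin (n G)) → (Fin L → Fin (n G)) → Set
Gradual G {L} x y =
  ∀ (i i' : Fin L) → toℕ i < toℕ i' → Edge G (x i') (y i) × ¬ Edge G (x i) (y i')

module _ {G : Graph} {j k : ℕ} (j<k : j < k) (W : LabelModule G j) where

  -- With interleaved p₀ < q₀ < p₁ < …, the x_{p_t} in W and the y_{q_t} outside W: two
  -- of the k vertices x_{p_s}, x_{p_t} (s < t) share a label, but y_{q_s} is adjacent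
  -- to x_{p_t} and not to x_{p_s}.
  no-alternation-xy : ∀ {L} {x y : Fin L → Fin (n G)} → Gradual G x y →
    (p q : Fin k → Fin L) → Interleaved p q →
    (pin : ∀ t → inside W (x (p t)) ≡ true) → (∀ t → inside W (y (q t)) ≡ false) → ⊥
  no-alternation-xy {x = x} {y} gradual p q (p<q , q<p) pin qout
    with pigeonhole j<k (λ t → colour W (x (p t)) (pin t))
  ... | s , t , s<t , same = proj₂ (gradual (p s) (q s) (p<q s))
    (trans (twins W (x (p s)) (x (p t)) (y (q s)) (pin s) (pin t) (qout s) same)
           (proj₁ (gradual (q s) (p t) (q<p s t s<t))))

  no-alternation-yx : ∀ {L} {x y : Fin L → Fin (n G)} → Gradual G x y →
    (p q : Fin k → Fin L) → Interleaved p q →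
    (pin : ∀ t → inside W (y (p t)) ≡ true) → (∀ t → inside W (x (q t)) ≡ false) → ⊥
  no-alternation-yx {x = x} {y} gradual p q (p<q , q<p) pin qout
    with pigeonhole j<k (λ t → colour W (y (p t)) (pin t))
  ... | s , t , s<t , same = proj₂ (gradual (q s) (p t) (q<p s t s<t)) (begin
    adj G (x (q s)) (y (p t))   ≡⟨ Graph.sym G (x (q s)) (y (p t)) ⟩
    adj G (y (p t)) (x (q s))   ≡⟨ sym (twins W (y (p s)) (y (p t)) (x (q s)) (pin s) (pin t) (qout s) same) ⟩
    adj G (y (p s)) (x (q s))   ≡⟨ Graph.sym G (y (p s)) (x (q s)) ⟩
    adj G (x (q s)) (y (p s))   ≡⟨ proj₁ (gradual (p s) (q s) (p<q s)) ⟩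
    true                        ∎)
    where open ≡-Reasoning

  -- If no k interleaved indices have x_p ∈ W and y_q ∉ W, then fewer than 2k indices d
  -- have x_d ∈ W and y_d ∉ W, as 2k of them would interleave.
  few-crossings : ∀ {L} {x y : Fin L → Fin (n G)} →
    (∀ p q → Interleaved p q → (∀ t → inside W (x (p t)) ≡ true) →
       (∀ t → inside W (y (q t)) ≡ false) → ⊥) →
    count (λ d → inside W (x d) ∧ not (inside W (y d))) < k + k
  few-crossings {x = x} {y} no-alternation with k + k ≤? count crossing
    where
    crossing : Fin _ → Bool
    crossing d = inside W (x d) ∧ not (inside W (y d))
  ... | no  ≰ = ≰⇒> ≰
  ... | yes ≤ with interleaved-positions k _ ≤
  ...   | p , q , il , Dp , Dq = ⊥-elim (no-alternation p q il
          (λ t → proj₁ (∧-true (Dp t))) (λ t → not-true (proj₂ (∧-true (Dq t)))))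

  count-step : ∀ {L} (x y : Fin L → Fin (n G)) →
    count (λ d → inside W (x d) ∧ not (inside W (y d))) < k + k →
    count (inside W ∘ x) < count (inside W ∘ y) + (k + k)
  count-step x y few = ≤-<-trans
    (count-subadditive _ (inside W ∘ y) _ (λ d → split (inside W (x d)) (inside W (y d))))
    (+-monoʳ-< (count (inside W ∘ y)) few)
    where
    split : ∀ a b → indicator a ≤ indicator b + indicator (a ∧ not b)
    split true  true  = s≤s z≤n
    split true  false = s≤s z≤n
    split false b     = z≤n

  gradual-balance : ∀ {X Y} → GraduallyConnected G X Y →
    meet W X < meet W Y + (k + k) × meet W Y < meet W X + (k + k)
  gradual-balance (_ , L , x , y , ox , oy , gradual) =
    subst₂ (λ a b → a < b + (k + k)) (ordering-count ox (inside W)) (ordering-count oy (inside W))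
      (count-step x y (few-crossings (no-alternation-xy gradual))) ,
    subst₂ (λ a b → a < b + (k + k)) (ordering-count oy (inside W)) (ordering-count ox (inside W))
      (count-step y x (few-crossings (no-alternation-yx gradual)))

-- The chain argument

2*k≡k+k : ∀ k → 2 * k ≡ k + k
2*k≡k+k k = cong (k +_) (+-identityʳ k)

part-size : ∀ {N r m} (part : Fin N → Fin r) → (∀ (i : Fin r) → ∣ PartAt part (toℕ i) ∣ ≡ m) →
  ∀ c → c < r → count (lookup (PartAt part c)) ≡ m
part-size {m = m} part size c c<r = trans (sym (∣∣≡count (PartAt part c)))
  (subst (λ c' → ∣ PartAt part c' ∣ ≡ m) (toℕ-fromℕ< c<r) (size (fromℕ< c<r)))

part-index : ∀ {N r} (part : Fin N → Fin r) {v c} → lookup (PartAt part c) v ≡ true →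
  toℕ (part v) ≡ c
part-index part {v} {c} v∈ with toℕ (part v) ≟ c | trans (sym (lookup∘tabulate _ v)) v∈
... | yes eq | _ = eq
... | no  _  | ()

module Chain {G : Graph} {r m : ℕ} (part : Fin (n G) → Fin r)
  (size : ∀ (i : Fin r) → ∣ PartAt part (toℕ i) ∣ ≡ m)
  (consecutive : ∀ (i i' : Fin r) → suc (toℕ i) ≡ toℕ i' →
     GraduallyConnected G (PartAt part (toℕ i)) (PartAt part (toℕ i')))
  {j k : ℕ} (j<k : j < k) (W : LabelModule G j) where

  V : ℕ → Subset (n G)
  V = PartAt part

  δ : ℕ
  δ = k + k

  a : ℕ → ℕ
  a c = meet W (V c)

  consecutive-gc : ∀ c → suc c < r → GraduallyConnected G (V c) (V (suc c))
  consecutive-gc c sc<r =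
    subst₂ (GraduallyConnected G) (cong V (toℕ-fromℕ< c<r)) (cong V (toℕ-fromℕ< sc<r))
      (consecutive (fromℕ< c<r) (fromℕ< sc<r)
        (trans (cong suc (toℕ-fromℕ< c<r)) (sym (toℕ-fromℕ< sc<r))))
    where
    c<r : c < r
    c<r = <-trans (n<1+n c) sc<r

  -- Along the chain, |W ∩ V c| moves by less than 2k per step, so by at most c·2k in all.
  drift : ∀ c → c < r → a 0 ≤ a c + c * δ × a c ≤ a 0 + c * δ
  drift zero    _    = m≤m+n (a 0) 0 , m≤m+n (a 0) 0
  drift (suc c) sc<r with drift c (<-trans (n<1+n c) sc<r)
                        | gradual-balance j<k W (consecutive-gc c sc<r)
  ... | down , up | forward , backward = lower , upper
    where
    lower : a 0 ≤ a (suc c) + (δ + c * δ)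
    lower = begin
      a 0                         ≤⟨ down ⟩
      a c + c * δ                 ≤⟨ +-monoˡ-≤ (c * δ) (<⇒≤ forward) ⟩
      a (suc c) + δ + c * δ       ≡⟨ +-assoc (a (suc c)) δ (c * δ) ⟩
      a (suc c) + (δ + c * δ)     ∎
      where open ≤-Reasoning
    upper : a (suc c) ≤ a 0 + (δ + c * δ)
    upper = begin
      a (suc c)                   ≤⟨ <⇒≤ backward ⟩
      a c + δ                     ≤⟨ +-monoˡ-≤ δ up ⟩
      a 0 + c * δ + δ             ≡⟨ +-assoc (a 0) (c * δ) δ ⟩
      a 0 + (c * δ + δ)           ≡⟨ cong (a 0 +_) (+-comm (c * δ) δ) ⟩
      a 0 + (δ + c * δ)           ∎
      where open ≤-Reasoning

  -- If W meets V 0 in T = 2kr < |W ∩ V 0| ≤ 2T vertices and m > 3T, then transversals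
  -- inside W of {V i : i ∈ I} and outside W of {V (i+1) : i ∈ I} exist; as they are
  -- gradually connected, this contradicts the balance of W.
  module _ (large : r * δ + r * δ + r * δ < m) (heavy : Balanced (r * δ) (a 0))
    (I : Subset r) (∣I∣ : ∣ I ∣ ≡ 2 * k) (I-bound : ∀ i → i ∈ I → suc (toℕ i) < r)
    (transversals : ∀ (X Y : Subset (n G)) → Transversal X (V ∘ toℕ) I →
       Transversal Y (V ∘ suc ∘ toℕ) I → GraduallyConnected G X Y) where

    -- Every part meets W, as |W ∩ V 0| > T ≥ c·2k.
    meets : ∀ c → c < r → ∃ λ v → lookup (V c) v ∧ inside W v ≡ true
    meets c c<r = count-witness _ (+-cancelʳ-< (c * δ) 0 (a c) (begin-strict
      c * δ         ≤⟨ *-monoˡ-≤ δ (<⇒≤ c<r) ⟩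
      r * δ         <⟨ proj₁ heavy ⟩
      a 0           ≤⟨ proj₁ (drift c c<r) ⟩
      a c + c * δ   ∎))
      where open ≤-Reasoning

    -- Every part leaves W, as |W ∩ V c| ≤ 2T + T < m.
    misses : ∀ c → c < r → ∃ λ v → lookup (V c) v ≡ true × inside W v ≡ false
    misses c c<r = count-gap (lookup (V c)) (inside W) (begin-strict
      a c                          ≤⟨ proj₂ (drift c c<r) ⟩
      a 0 + c * δ                  ≤⟨ +-mono-≤ (proj₂ heavy) (*-monoˡ-≤ δ (<⇒≤ c<r)) ⟩
      r * δ + r * δ + r * δ        <⟨ large ⟩
      m                            ≡⟨ sym (part-size part size c c<r) ⟩
      count (lookup (V c))         ∎)
      where open ≤-Reasoning

    x₀ y₀ : (i : Fin r) → i ∈ I → Fin (n G)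
    x₀ i _ = proj₁ (meets (toℕ i) (toℕ<n i))
    y₀ i p = proj₁ (misses (suc (toℕ i)) (I-bound i p))

    x₀-inside : ∀ i p → lookup (V (toℕ i)) (x₀ i p) ≡ true × inside W (x₀ i p) ≡ true
    x₀-inside i _ = ∧-true (proj₂ (meets (toℕ i) (toℕ<n i)))

    y₀-outside : ∀ i p → lookup (V (suc (toℕ i))) (y₀ i p) ≡ true × inside W (y₀ i p) ≡ false
    y₀-outside i p = proj₂ (misses (suc (toℕ i)) (I-bound i p))

    x₀-injective : ∀ i i' p p' → x₀ i p ≡ x₀ i' p' → i ≡ i'
    x₀-injective i i' p p' eq = toℕ-injective
      (trans (sym (part-index part (proj₁ (x₀-inside i p))))
      (trans (cong (toℕ ∘ part) eq) (part-index part (proj₁ (x₀-inside i' p')))))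

    y₀-injective : ∀ i i' p p' → y₀ i p ≡ y₀ i' p' → i ≡ i'
    y₀-injective i i' p p' eq = toℕ-injective (suc-injective
      (trans (sym (part-index part (proj₁ (y₀-outside i p))))
      (trans (cong (toℕ ∘ part) eq) (part-index part (proj₁ (y₀-outside i' p'))))))

    X Y : Subset (n G)
    X = Chosen I x₀
    Y = Chosen I y₀

    X-in-W : k + k ≤ meet W X
    X-in-W = subst (_≤ meet W X)
      (trans (sym (∣∣≡count I)) (trans ∣I∣ (2*k≡k+k k)))
      (count-injection (lookup I) _ (λ i q → x₀ i (lookup⇒[]= i I q))
        (λ i i' q q' → x₀-injective i i' (lookup⇒[]= i I q) (lookup⇒[]= i' I q'))
        (λ i q → cong₂ _∧_ (chosen-member I x₀ i (lookup⇒[]= i I q))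
                            (proj₂ (x₀-inside i (lookup⇒[]= i I q)))))

    Y-off-W : meet W Y ≡ 0
    Y-off-W = count-none _ (chosen-avoids I y₀ (inside W) (λ i p → proj₂ (y₀-outside i p)))

    contradiction : ⊥
    contradiction = <⇒≱ (proj₁ (gradual-balance j<k W gc)) (begin
      meet W Y + (k + k)   ≡⟨ cong (_+ (k + k)) Y-off-W ⟩
      k + k                ≤⟨ X-in-W ⟩
      meet W X             ∎)
      where
      open ≤-Reasoning
      gc : GraduallyConnected G X Y
      gc = transversals X Y
        (chosen-transversal I x₀ (V ∘ toℕ)
          (λ i p → lookup⇒[]= _ _ (proj₁ (x₀-inside i p))) x₀-injective)
        (chosen-transversal I y₀ (V ∘ suc ∘ toℕ)
          (λ i p → lookup⇒[]= _ _ (proj₁ (y₀-outside i p))) y₀-injective)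

-- 6kr = 3T for T = 2kr.
arith : ∀ k r → 6 * k * r ≡ r * (k + k) + r * (k + k) + r * (k + k)
arith = solve-∀

lemma13 : (k : ℕ) (G : Graph) (r m : ℕ) (part : Fin (n G) → Fin r) →
    (∀ (i : Fin r) → ∣ PartAt part (toℕ i) ∣ ≡ m) →
    6 * k * r < m →
    (∀ (i j : Fin r) → suc (toℕ i) ≡ toℕ j →
       GraduallyConnected G (PartAt part (toℕ i)) (PartAt part (toℕ j))) →
    (I : Subset r) → ∣ I ∣ ≡ 2 * k →
    (∀ (i : Fin r) → i ∈ I → suc (toℕ i) < r) →
    (∀ (X Y : Subset (n G)) →
       Transversal X (λ i → PartAt part (toℕ i)) I →
       Transversal Y (λ i → PartAt part (suc (toℕ i))) I →
       GraduallyConnected G X Y) →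
    CliqueWidth≥ k G
lemma13 k G r m part size 6kr<m consecutive I ∣I∣ I-bound transversals j j<k cw =
  let W , heavy = balanced-module {G = G} cw (lookup (PartAt part 0)) T 1≤T T<m
  in  Chain.contradiction {G = G} part size consecutive j<k W 3T<m heavy I ∣I∣ I-bound transversals
  where
  T : ℕ
  T = r * (k + k)
  3T<m : T + T + T < m
  3T<m = subst (_< m) (arith k r) 6kr<m
  0<2k : 0 < k + k
  0<2k = ≤-trans (≤-trans (s≤s z≤n) j<k) (m≤m+n k k)
  -- I has 2k > 0 elements, so there is at least one part
  0<r : 0 < r
  0<r with count-witness (lookup I)
             (subst (0 <_) (trans (sym (2*k≡k+k k)) (trans (sym ∣I∣) (∣∣≡count I))) 0<2k)
  ... | i , _ = ≤-<-trans z≤n (toℕ<n i)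
  1≤T : 1 ≤ T
  1≤T = *-mono-≤ 0<r 0<2k
  T<m : T < count (lookup (PartAt part 0))
  T<m = subst (T <_) (sym (part-size part size 0 0<r))
          (≤-<-trans (≤-trans (m≤m+n T T) (m≤m+n (T + T) T)) 3T<m)
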